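{- For $\ell \in A^2$ a row vector, and $\eta \in A^2$ a column vector, $\ell^{!}$ and $\eta^{!}$ are rank at most one, and one has $\langle \ell^{!},\eta^{!}\rangle = n_{A}\left(\ell \begin{pmatrix} 0&1\\-1&0\end{pmatrix} \eta\right)$.
   Context: $A$ is an associative cubic norm structure over a field $F$ of characteristic $0$ with cubic norm $n=n_A$, adjoint $\#$ and trace pairing $(\cdot,\cdot)$. $W_A=F\oplus A\oplus A\oplus F$ with symplectic form $\langle(a,b,c,d),(a',b',c',d')\rangle=ad'-(b,c')+(c,b')-da'$ and the Freudenthal notion of rank. For a row vector $\ell=(s,t)\in A^2$, $\ell^!=(n(s),s^\#t,t^\#s,n(t))\in W_A$; for a column vector $\eta=(u,v)^t\in A^2$, $\eta^!=(n(u),vu^\#,uv^\#,n(v))\in W_A$. -}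

module Defs where

open import Level using (Level; _⊔_) renaming (suc to lsuc)
open import Data.Nat using (ℕ; zero; suc)
open import Data.Product using (_×_; _,_; ∃)
open import Relation.Nullary using (¬_)
open import Algebra.Bundles using (CommutativeRing)
open import Algebra.Module.Bundles using (Module)

record Field (c ℓ : Level) : Set (lsuc (c ⊔ ℓ)) where
  field
    commutativeRing : CommutativeRing c ℓ
  open CommutativeRing commutativeRing public
  field
    0≉1     : ¬ (0# ≈ 1#)
    inverse : ∀ x → ¬ (x ≈ 0#) → ∃ λ y → x * y ≈ 1#

  fromℕ : ℕ → Carrier
  fromℕ zero    = 0#
  fromℕ (suc k) = 1# + fromℕ k

CharacteristicZero : ∀ {c ℓ} → Field c ℓ → Set ℓ
CharacteristicZero F = ∀ k → ¬ (fromℕ (suc k) ≈ 0#)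
  where open Field F

-- A is an F-vector space (stdlib Module over the commutative ring of F),
-- an associative unital F-algebra (multiplication _·_, unit 1A), with a
-- cubic norm structure (n, #, trace pairing ⟪_,_⟫, base point 1A) in the
-- sense of McCrimmon, compatible with the algebra structure.

record AssocCubicNormStructure {c ℓ : Level} (F : Field c ℓ) (m ℓm : Level)
       : Set (lsuc (c ⊔ ℓ ⊔ m ⊔ ℓm)) where
  open Field F
  field
    vectorSpace : Module commutativeRing m ℓm
  open Module vectorSpace public

  A : Set m
  A = Carrierᴹ

  infixl 6 _∸ᴹ_
  _∸ᴹ_ : A → A → A
  x ∸ᴹ y = x +ᴹ (-ᴹ y)

  infixl 7 _·_
  field
    _·_   : A → A → A
    1A    : A
    n     : A → Carrier
    _#    : A → A
    ⟪_,_⟫ : A → A → Carrier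

  _⨯_ : A → A → A
  x ⨯ y = ((x +ᴹ y) #) ∸ᴹ (x #) ∸ᴹ (y #)

  field
    ·-cong  : ∀ {x x' y y'} → x ≈ᴹ x' → y ≈ᴹ y' → (x · y) ≈ᴹ (x' · y')
    n-cong  : ∀ {x x'} → x ≈ᴹ x' → n x ≈ n x'
    #-cong  : ∀ {x x'} → x ≈ᴹ x' → (x #) ≈ᴹ (x' #)
    ⟪⟫-cong : ∀ {x x' y y'} → x ≈ᴹ x' → y ≈ᴹ y' → ⟪ x , y ⟫ ≈ ⟪ x' , y' ⟫

    ·-assoc      : ∀ x y z → ((x · y) · z) ≈ᴹ (x · (y · z))
    ·-identityˡ  : ∀ x → (1A · x) ≈ᴹ x
    ·-identityʳ  : ∀ x → (x · 1A) ≈ᴹ x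
    ·-distribˡ   : ∀ x y z → (x · (y +ᴹ z)) ≈ᴹ ((x · y) +ᴹ (x · z))
    ·-distribʳ   : ∀ x y z → ((y +ᴹ z) · x) ≈ᴹ ((y · x) +ᴹ (z · x))
    ·-*ₗ-assocˡ  : ∀ r x y → ((r *ₗ x) · y) ≈ᴹ (r *ₗ (x · y))
    ·-*ₗ-assocʳ  : ∀ r x y → (x · (r *ₗ y)) ≈ᴹ (r *ₗ (x · y))

    ⟪⟫-sym      : ∀ x y → ⟪ x , y ⟫ ≈ ⟪ y , x ⟫
    ⟪⟫-+ˡ       : ∀ x y z → ⟪ x +ᴹ y , z ⟫ ≈ ⟪ x , z ⟫ + ⟪ y , z ⟫
    ⟪⟫-*ₗˡ      : ∀ r x y → ⟪ r *ₗ x , y ⟫ ≈ r * ⟪ x , y ⟫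
    ⟪⟫-nondegen : ∀ x → (∀ y → ⟪ x , y ⟫ ≈ 0#) → x ≈ᴹ 0ᴹ

    -- # is a quadratic map: homogeneous of degree 2 with bilinear polarisation
    #-homog  : ∀ r x → ((r *ₗ x) #) ≈ᴹ ((r * r) *ₗ (x #))
    ⨯-+ˡ     : ∀ x y z → ((x +ᴹ y) ⨯ z) ≈ᴹ ((x ⨯ z) +ᴹ (y ⨯ z))
    ⨯-*ₗˡ    : ∀ r x y → ((r *ₗ x) ⨯ y) ≈ᴹ (r *ₗ (x ⨯ y))

    -- n is a cubic form whose expansion is governed by # and ⟪_,_⟫
    n-homog  : ∀ r x → n (r *ₗ x) ≈ r * r * r * n x
    n-expand : ∀ t x y →
      n (x +ᴹ t *ₗ y) ≈ n x + t * ⟪ x # , y ⟫ + t * t * ⟪ x , y # ⟫ + t * t * t * n y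

    n-1      : n 1A ≈ 1#
    1-#      : (1A #) ≈ᴹ 1A
    ##       : ∀ x → ((x #) #) ≈ᴹ (n x *ₗ x)
    1-⨯      : ∀ y → (1A ⨯ y) ≈ᴹ (⟪ 1A , y ⟫ *ₗ 1A ∸ᴹ y)

    ·-#ʳ       : ∀ x → (x · (x #)) ≈ᴹ (n x *ₗ 1A)
    ·-#ˡ       : ∀ x → ((x #) · x) ≈ᴹ (n x *ₗ 1A)
    ⟪⟫-trace   : ∀ x y → ⟪ x , y ⟫ ≈ ⟪ 1A , x · y ⟫
    n-mult     : ∀ x y → n (x · y) ≈ n x * n y
    #-antimult : ∀ x y → ((x · y) #) ≈ᴹ ((y #) · (x #))

module FreudenthalSpace {c ℓ m ℓm : Level} {F : Field c ℓ}
                        (AS : AssocCubicNormStructure F m ℓm) where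
  open Field F
  open AssocCubicNormStructure AS

  W : Set (c ⊔ m)
  W = Carrier × A × A × Carrier

  ⟨_,_⟩W : W → W → Carrier
  ⟨ (a , b , c′ , d) , (a' , b' , c' , d') ⟩W =
    a * d' - ⟪ b , c' ⟫ + ⟪ c′ , b' ⟫ - d * a'

  RankAtMostOne : W → Set (m ⊔ ℓm)
  RankAtMostOne (a , b , c′ , d) =
    ((b #) ≈ᴹ (a *ₗ c′)) ×
    ((c′ #) ≈ᴹ (d *ₗ b)) ×
    (∀ y → (c′ ⨯ (b ⨯ y)) ≈ᴹ ((a * d) *ₗ y +ᴹ ⟪ c′ , y ⟫ *ₗ b)) ×
    (∀ y → (b ⨯ (c′ ⨯ y)) ≈ᴹ ((a * d) *ₗ y +ᴹ ⟪ b , y ⟫ *ₗ c′))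

  record Row : Set m where
    constructor row
    field s t : A

  record Col : Set m where
    constructor col
    field u v : A

  _!ʳ : Row → W
  row s t !ʳ = n s , (s #) · t , (t #) · s , n t

  _!ᶜ : Col → W
  col u v !ᶜ = n u , v · (u #) , u · (v #) , n v

  -- right multiplication of a row vector by the matrix J = ( 0 1 ; -1 0 ):
  -- (s , t) J = (s·0 + t·(-1) , s·1 + t·0) = (-t , s)
  _·J : Row → Row
  row s t ·J = row (-ᴹ t) s

  _⊙_ : Row → Col → A
  row x y ⊙ col u v = x · u +ᴹ y · v

module Submission where

-- Besides (s# t)# = n(s) t# s, which follows from the
-- anti-multiplicativity of # and x## = n(x) x, the rank condition asks for
--   (t# s) × ((s# t) × y) = n(s) n(t) y + ⟪t# s , y⟫ s# t        (and s ↔ t).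
-- Via the product rules (x z) × (x' z) = z# (x × x') and
-- (z x) × (z x') = (x × x') z# this reduces to the adjoint identity
-- x# × (x × y) = n(x) y + ⟪x# , y⟫ x, which we obtain from the associative
-- structure through x# × w = ⟪x , w⟫ x - x w x, instead of linearising
-- x## = n(x) x; so characteristic 0 is never used.  A column vector is a row
-- vector of the opposite algebra, again an associative cubic norm structure,
-- so the column case is the row case applied to the opposite structure.
--
-- Pairing.  Expand n(-t u + s v) by n(x + y) = n x + ⟪x# , y⟫ + ⟪x , y#⟫ + n y
-- and rearrange each mixed term using the associativity of the trace pairing.

open import Defs
open import Level using (Level)
open import Data.Product using (_×_; _,_)
import Algebra.Solver.CommutativeMonoid as CommutativeMonoidSolver
import Algebra.Properties.Group as GroupProperties
import Algebra.Properties.Ring as RingProperties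
import Relation.Binary.Reasoning.Setoid as SetoidReasoning

-- The opposite algebra (x , y) ↦ y · x with the same norm, adjoint and trace
-- pairing is again an associative cubic norm structure: each axiom is either
-- invariant under reversing products or exchanged with its mirror image.
opposite : ∀ {c ℓ m ℓm} {F : Field c ℓ} →
           AssocCubicNormStructure F m ℓm → AssocCubicNormStructure F m ℓm
opposite {F = F} AS = record
  { vectorSpace = vectorSpace
  ; _·_ = λ x y → y · x
  ; 1A = 1A ; n = n ; _# = _# ; ⟪_,_⟫ = ⟪_,_⟫
  ; ·-cong = λ p q → ·-cong q p
  ; n-cong = n-cong ; #-cong = #-cong ; ⟪⟫-cong = ⟪⟫-cong
  ; ·-assoc = λ x y z → ≈ᴹ-sym (·-assoc z y x)
  ; ·-identityˡ = ·-identityʳ ; ·-identityʳ = ·-identityˡ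
  ; ·-distribˡ = ·-distribʳ ; ·-distribʳ = ·-distribˡ
  ; ·-*ₗ-assocˡ = λ r x y → ·-*ₗ-assocʳ r y x
  ; ·-*ₗ-assocʳ = λ r x y → ·-*ₗ-assocˡ r y x
  ; ⟪⟫-sym = ⟪⟫-sym ; ⟪⟫-+ˡ = ⟪⟫-+ˡ ; ⟪⟫-*ₗˡ = ⟪⟫-*ₗˡ ; ⟪⟫-nondegen = ⟪⟫-nondegen
  ; #-homog = #-homog ; ⨯-+ˡ = ⨯-+ˡ ; ⨯-*ₗˡ = ⨯-*ₗˡ
  ; n-homog = n-homog ; n-expand = n-expand
  ; n-1 = n-1 ; 1-# = 1-# ; ## = ## ; 1-⨯ = 1-⨯
  ; ·-#ʳ = ·-#ˡ ; ·-#ˡ = ·-#ʳ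
  ; ⟪⟫-trace = λ x y → trans (⟪⟫-sym x y) (⟪⟫-trace y x)
  ; n-mult = λ x y → trans (n-mult y x) (*-comm _ _)
  ; #-antimult = λ x y → #-antimult y x
  }
  where
  open Field F
  open AssocCubicNormStructure AS

module Identities {c ℓ m ℓm : Level} {F : Field c ℓ}
                  (AS : AssocCubicNormStructure F m ℓm) where
  open Field F
  open AssocCubicNormStructure AS
  module +ᴹ-Solver = CommutativeMonoidSolver +ᴹ-commutativeMonoid
  module +-Solver = CommutativeMonoidSolver +-commutativeMonoid
  module +ᴹ = GroupProperties +ᴹ-group
  module +F = GroupProperties +-group
  module FRing = RingProperties ring

  ∸ᴹ-cong : ∀ {a a' b b'} → a ≈ᴹ a' → b ≈ᴹ b' → (a ∸ᴹ b) ≈ᴹ (a' ∸ᴹ b')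
  ∸ᴹ-cong p q = +ᴹ-cong p (-ᴹ‿cong q)

  -1*ₗx≈-ᴹx : ∀ x → ((- 1#) *ₗ x) ≈ᴹ (-ᴹ x)
  -1*ₗx≈-ᴹx x = +ᴹ.inverseˡ-unique ((- 1#) *ₗ x) x (begin
    ((- 1#) *ₗ x) +ᴹ x          ≈⟨ +ᴹ-congˡ (≈ᴹ-sym (*ₗ-identityˡ x)) ⟩
    ((- 1#) *ₗ x) +ᴹ (1# *ₗ x)  ≈⟨ ≈ᴹ-sym (*ₗ-distribʳ x (- 1#) 1#) ⟩
    ((- 1#) + 1#) *ₗ x          ≈⟨ *ₗ-congʳ (-‿inverseˡ 1#) ⟩
    0# *ₗ x                     ≈⟨ *ₗ-zeroˡ x ⟩
    0ᴹ                          ∎)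
    where open SetoidReasoning ≈ᴹ-setoid

  -1*-1≈1 : - 1# * - 1# ≈ 1#
  -1*-1≈1 = trans (FRing.-1*x≈-x (- 1#)) (+F.⁻¹-involutive 1#)

  #-negate : ∀ x → ((-ᴹ x) #) ≈ᴹ (x #)
  #-negate x = ≈ᴹ-trans (#-cong (≈ᴹ-sym (-1*ₗx≈-ᴹx x)))
    (≈ᴹ-trans (#-homog _ x) (≈ᴹ-trans (*ₗ-congʳ -1*-1≈1) (*ₗ-identityˡ _)))

  n-negate : ∀ x → n (-ᴹ x) ≈ - n x
  n-negate x = trans (n-cong (≈ᴹ-sym (-1*ₗx≈-ᴹx x)))
    (trans (n-homog _ x)
      (trans (*-congʳ (trans (*-congʳ -1*-1≈1) (*-identityˡ _))) (FRing.-1*x≈-x _)))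

  ⟪⟫-negˡ : ∀ x y → ⟪ -ᴹ x , y ⟫ ≈ - ⟪ x , y ⟫
  ⟪⟫-negˡ x y = trans (⟪⟫-cong (≈ᴹ-sym (-1*ₗx≈-ᴹx x)) ≈ᴹ-refl)
    (trans (⟪⟫-*ₗˡ (- 1#) x y) (FRing.-1*x≈-x _))

  ⟪⟫-∸ˡ : ∀ x y z → ⟪ x ∸ᴹ y , z ⟫ ≈ ⟪ x , z ⟫ + - ⟪ y , z ⟫
  ⟪⟫-∸ˡ x y z = trans (⟪⟫-+ˡ x (-ᴹ y) z) (+-congˡ (⟪⟫-negˡ y z))

  ·-negˡ : ∀ x y → ((-ᴹ x) · y) ≈ᴹ (-ᴹ (x · y))
  ·-negˡ x y = ≈ᴹ-trans (·-cong (≈ᴹ-sym (-1*ₗx≈-ᴹx x)) ≈ᴹ-refl)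
    (≈ᴹ-trans (·-*ₗ-assocˡ (- 1#) x y) (-1*ₗx≈-ᴹx (x · y)))

  ·-∸ʳ : ∀ x y z → (x · (y ∸ᴹ z)) ≈ᴹ ((x · y) ∸ᴹ (x · z))
  ·-∸ʳ x y z = ≈ᴹ-trans (·-distribˡ x y (-ᴹ z)) (+ᴹ-congˡ (begin
    x · (-ᴹ z)          ≈⟨ ·-cong ≈ᴹ-refl (≈ᴹ-sym (-1*ₗx≈-ᴹx z)) ⟩
    x · ((- 1#) *ₗ z)   ≈⟨ ·-*ₗ-assocʳ (- 1#) x z ⟩
    (- 1#) *ₗ (x · z)   ≈⟨ -1*ₗx≈-ᴹx (x · z) ⟩
    -ᴹ (x · z)          ∎))
    where open SetoidReasoning ≈ᴹ-setoid

  ≈ᴹ-by-pairing : ∀ u v → (∀ z → ⟪ u , z ⟫ ≈ ⟪ v , z ⟫) → u ≈ᴹ v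
  ≈ᴹ-by-pairing u v h = +ᴹ.x∙y⁻¹≈ε⇒x≈y u v (⟪⟫-nondegen (u ∸ᴹ v)
    λ z → trans (⟪⟫-∸ˡ u v z) (trans (+-congʳ (h z)) (-‿inverseʳ _)))

  ⟪⟫-assoc : ∀ a b c → ⟪ a · b , c ⟫ ≈ ⟪ a , b · c ⟫
  ⟪⟫-assoc a b c = trans (⟪⟫-trace (a · b) c)
    (trans (⟪⟫-cong ≈ᴹ-refl (·-assoc a b c)) (sym (⟪⟫-trace a (b · c))))

  ⟪#,⟫-rotate : ∀ a b c d → ⟪ (a · b) # , c · d ⟫ ≈ ⟪ (a #) · c , d · (b #) ⟫
  ⟪#,⟫-rotate a b c d = begin
    ⟪ (a · b) # , c · d ⟫         ≈⟨ ⟪⟫-cong (#-antimult a b) ≈ᴹ-refl ⟩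
    ⟪ (b #) · (a #) , c · d ⟫     ≈⟨ ⟪⟫-assoc _ _ _ ⟩
    ⟪ b # , (a #) · (c · d) ⟫     ≈⟨ ⟪⟫-sym _ _ ⟩
    ⟪ (a #) · (c · d) , b # ⟫     ≈⟨ ⟪⟫-cong (≈ᴹ-sym (·-assoc _ _ _)) ≈ᴹ-refl ⟩
    ⟪ ((a #) · c) · d , b # ⟫     ≈⟨ ⟪⟫-assoc _ _ _ ⟩
    ⟪ (a #) · c , d · (b #) ⟫     ∎
    where open SetoidReasoning setoid

  ⨯-cong : ∀ {x x' y y'} → x ≈ᴹ x' → y ≈ᴹ y' → (x ⨯ y) ≈ᴹ (x' ⨯ y')
  ⨯-cong p q = ∸ᴹ-cong (∸ᴹ-cong (#-cong (+ᴹ-cong p q)) (#-cong p)) (#-cong q)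

  ⨯-comm : ∀ x y → (x ⨯ y) ≈ᴹ (y ⨯ x)
  ⨯-comm x y = ≈ᴹ-trans
    (+ᴹ-Solver.solve 3 (λ a b c → ((a ⊕ b) ⊕ c) ⊜ ((a ⊕ c) ⊕ b))
       ≈ᴹ-refl ((x +ᴹ y) #) (-ᴹ (x #)) (-ᴹ (y #)))
    (∸ᴹ-cong (∸ᴹ-cong (#-cong (+ᴹ-comm x y)) ≈ᴹ-refl) ≈ᴹ-refl)
    where open +ᴹ-Solver using (_⊕_; _⊜_)

  #-+ : ∀ x y → ((x +ᴹ y) #) ≈ᴹ ((x ⨯ y) +ᴹ (y #) +ᴹ (x #))
  #-+ x y = ≈ᴹ-sym (≈ᴹ-trans (+ᴹ-congʳ (+ᴹ.//-rightDividesˡ (y #) _))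
                             (+ᴹ.//-rightDividesˡ (x #) _))

  n-+ : ∀ x y → n (x +ᴹ y) ≈ n x + ⟪ x # , y ⟫ + ⟪ x , y # ⟫ + n y
  n-+ x y = begin
    n (x +ᴹ y)         ≈⟨ n-cong (+ᴹ-congˡ (≈ᴹ-sym (*ₗ-identityˡ y))) ⟩
    n (x +ᴹ 1# *ₗ y)   ≈⟨ n-expand 1# x y ⟩
    n x + 1# * ⟪ x # , y ⟫ + 1# * 1# * ⟪ x , y # ⟫ + 1# * 1# * 1# * n y
      ≈⟨ +-cong (+-cong (+-congˡ (*-identityˡ _)) (1²*a _)) (trans (*-congʳ (1²*a 1#)) (*-identityˡ _)) ⟩
    n x + ⟪ x # , y ⟫ + ⟪ x , y # ⟫ + n y ∎
    where
    open SetoidReasoning setoid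
    1²*a : ∀ a → 1# * 1# * a ≈ a
    1²*a a = trans (*-congʳ (*-identityˡ 1#)) (*-identityˡ a)

  -- the terms of n(x + y + z) other than ⟪x × y , z⟫
  remainder : A → A → A → Carrier
  remainder x y z = n x + n y + n z + ⟪ x # , y ⟫ + ⟪ x , y # ⟫
                    + ⟪ x # , z ⟫ + ⟪ x , z # ⟫ + ⟪ y # , z ⟫ + ⟪ y , z # ⟫

  n-+-+ : ∀ x y z → n ((x +ᴹ y) +ᴹ z) ≈ ⟪ x ⨯ y , z ⟫ + remainder x y z
  n-+-+ x y z = begin
    n ((x +ᴹ y) +ᴹ z) ≈⟨ n-+ (x +ᴹ y) z ⟩
    n (x +ᴹ y) + ⟪ (x +ᴹ y) # , z ⟫ + ⟪ x +ᴹ y , z # ⟫ + n z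
      ≈⟨ +-congʳ (+-cong (+-cong (n-+ x y) #-term) (⟪⟫-+ˡ x y (z #))) ⟩
    n x + ⟪ x # , y ⟫ + ⟪ x , y # ⟫ + n y + (⟪ x ⨯ y , z ⟫ + ⟪ y # , z ⟫ + ⟪ x # , z ⟫)
      + (⟪ x , z # ⟫ + ⟪ y , z # ⟫) + n z
      ≈⟨ +-Solver.solve 10 (λ nx ny nz p q r s u v w →
           (((((nx ⊕ p) ⊕ q) ⊕ ny) ⊕ ((w ⊕ u) ⊕ r)) ⊕ (s ⊕ v)) ⊕ nz
           ⊜ w ⊕ ((((((((nx ⊕ ny) ⊕ nz) ⊕ p) ⊕ q) ⊕ r) ⊕ s) ⊕ u) ⊕ v))
           refl (n x) (n y) (n z) ⟪ x # , y ⟫ ⟪ x , y # ⟫ ⟪ x # , z ⟫ ⟪ x , z # ⟫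
           ⟪ y # , z ⟫ ⟪ y , z # ⟫ ⟪ x ⨯ y , z ⟫ ⟩
    ⟪ x ⨯ y , z ⟫ + remainder x y z ∎
    where
    open SetoidReasoning setoid
    open +-Solver using (_⊕_; _⊜_)
    #-term : ⟪ (x +ᴹ y) # , z ⟫ ≈ ⟪ x ⨯ y , z ⟫ + ⟪ y # , z ⟫ + ⟪ x # , z ⟫
    #-term = trans (⟪⟫-cong (#-+ x y) ≈ᴹ-refl)
      (trans (⟪⟫-+ˡ _ _ z) (+-congʳ (⟪⟫-+ˡ _ _ z)))

  remainder-swap : ∀ x y z → remainder x z y ≈ remainder x y z
  remainder-swap x y z =
    trans (+-cong (+-congˡ (⟪⟫-sym (z #) y)) (⟪⟫-sym z (y #)))
      (+-Solver.solve 9 (λ nx ny nz p q r s u v →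
         ((((((((nx ⊕ nz) ⊕ ny) ⊕ r) ⊕ s) ⊕ p) ⊕ q) ⊕ v) ⊕ u)
         ⊜ ((((((((nx ⊕ ny) ⊕ nz) ⊕ p) ⊕ q) ⊕ r) ⊕ s) ⊕ u) ⊕ v))
         refl (n x) (n y) (n z) ⟪ x # , y ⟫ ⟪ x , y # ⟫ ⟪ x # , z ⟫ ⟪ x , z # ⟫
         ⟪ y # , z ⟫ ⟪ y , z # ⟫)
    where open +-Solver using (_⊕_; _⊜_)

  -- ⟪x × y , z⟫ is symmetric in y and z, since n(x + y + z) is
  ⟪⨯⟫-swap : ∀ x y z → ⟪ x ⨯ y , z ⟫ ≈ ⟪ x ⨯ z , y ⟫
  ⟪⨯⟫-swap x y z = +F.∙-cancelʳ (remainder x y z) _ _ (begin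
    ⟪ x ⨯ y , z ⟫ + remainder x y z  ≈⟨ n-+-+ x y z ⟨
    n ((x +ᴹ y) +ᴹ z)                ≈⟨ n-cong (+ᴹ-Solver.solve 3 (λ a b c → ((a ⊕ b) ⊕ c) ⊜ ((a ⊕ c) ⊕ b)) ≈ᴹ-refl x y z) ⟩
    n ((x +ᴹ z) +ᴹ y)                ≈⟨ n-+-+ x z y ⟩
    ⟪ x ⨯ z , y ⟫ + remainder x z y  ≈⟨ +-congˡ (remainder-swap x y z) ⟩
    ⟪ x ⨯ z , y ⟫ + remainder x y z  ∎)
    where
    open SetoidReasoning setoid
    open +ᴹ-Solver using (_⊕_; _⊜_)

  ⟪⨯⟫-assoc : ∀ a b c → ⟪ a ⨯ b , c ⟫ ≈ ⟪ a , b ⨯ c ⟫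
  ⟪⨯⟫-assoc a b c = trans (⟪⟫-cong (⨯-comm a b) ≈ᴹ-refl)
    (trans (⟪⨯⟫-swap b a c) (⟪⟫-sym (b ⨯ c) a))

  -- x × x = 2 x#, from (2 x)# = 4 x#
  ⨯-self : ∀ x → (x ⨯ x) ≈ᴹ ((x #) +ᴹ (x #))
  ⨯-self x = begin
    ((x +ᴹ x) #) ∸ᴹ (x #) ∸ᴹ (x #)          ≈⟨ ∸ᴹ-cong (∸ᴹ-cong #-double ≈ᴹ-refl) ≈ᴹ-refl ⟩
    (((X +ᴹ X) +ᴹ X) +ᴹ X) ∸ᴹ X ∸ᴹ X        ≈⟨ ∸ᴹ-cong (+ᴹ.//-rightDividesʳ X _) ≈ᴹ-refl ⟩
    ((X +ᴹ X) +ᴹ X) ∸ᴹ X                    ≈⟨ +ᴹ.//-rightDividesʳ X _ ⟩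
    X +ᴹ X                                  ∎
    where
    open SetoidReasoning ≈ᴹ-setoid
    X = x #
    2*ₗ : ∀ y → ((1# + 1#) *ₗ y) ≈ᴹ (y +ᴹ y)
    2*ₗ y = ≈ᴹ-trans (*ₗ-distribʳ y 1# 1#) (+ᴹ-cong (*ₗ-identityˡ y) (*ₗ-identityˡ y))
    #-double : ((x +ᴹ x) #) ≈ᴹ (((X +ᴹ X) +ᴹ X) +ᴹ X)
    #-double = begin
      (x +ᴹ x) #                                   ≈⟨ #-cong (≈ᴹ-sym (2*ₗ x)) ⟩
      ((1# + 1#) *ₗ x) #                           ≈⟨ #-homog _ x ⟩
      ((1# + 1#) * (1# + 1#)) *ₗ X                 ≈⟨ *ₗ-assoc _ _ _ ⟩
      (1# + 1#) *ₗ ((1# + 1#) *ₗ X)                ≈⟨ 2*ₗ _ ⟩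
      ((1# + 1#) *ₗ X) +ᴹ ((1# + 1#) *ₗ X)         ≈⟨ +ᴹ-cong (2*ₗ X) (2*ₗ X) ⟩
      (X +ᴹ X) +ᴹ (X +ᴹ X)                         ≈⟨ +ᴹ-assoc (X +ᴹ X) X X ⟨
      ((X +ᴹ X) +ᴹ X) +ᴹ X                         ∎

  ⟪⟫-⨯-self : ∀ x y → ⟪ x , x ⨯ y ⟫ ≈ ⟪ x # , y ⟫ + ⟪ x # , y ⟫
  ⟪⟫-⨯-self x y = trans (sym (⟪⨯⟫-assoc x x y))
    (trans (⟪⟫-cong (⨯-self x) ≈ᴹ-refl) (⟪⟫-+ˡ _ _ _))

  -- product rule: (x z) × (x' z) = z# (x × x'), as # is anti-multiplicative
  ⨯-·ʳ : ∀ x x' z → ((x · z) ⨯ (x' · z)) ≈ᴹ ((z #) · (x ⨯ x'))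
  ⨯-·ʳ x x' z = begin
    ((((x · z) +ᴹ (x' · z)) #) ∸ᴹ ((x · z) #)) ∸ᴹ ((x' · z) #)
      ≈⟨ ∸ᴹ-cong (∸ᴹ-cong (≈ᴹ-trans (#-cong (≈ᴹ-sym (·-distribʳ z x x'))) (#-antimult (x +ᴹ x') z))
                          (#-antimult x z)) (#-antimult x' z) ⟩
    (((z #) · ((x +ᴹ x') #)) ∸ᴹ ((z #) · (x #))) ∸ᴹ ((z #) · (x' #))
      ≈⟨ ∸ᴹ-cong (≈ᴹ-sym (·-∸ʳ _ _ _)) ≈ᴹ-refl ⟩
    ((z #) · (((x +ᴹ x') #) ∸ᴹ (x #))) ∸ᴹ ((z #) · (x' #))
      ≈⟨ ≈ᴹ-sym (·-∸ʳ _ _ _) ⟩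
    (z #) · (x ⨯ x') ∎
    where open SetoidReasoning ≈ᴹ-setoid

module AdjointIdentity {c ℓ m ℓm : Level} {F : Field c ℓ}
                       (AS : AssocCubicNormStructure F m ℓm) where
  open Field F
  open AssocCubicNormStructure AS
  open Identities AS
  -- the mirror image of ⨯-·ʳ: (z x) × (z x') = (x × x') z#
  open Identities (opposite AS) using () renaming (⨯-·ʳ to ⨯-·ˡ)

  -- x × (z x) = ⟪1 , z⟫ x# - x# z, the product rule applied to x = 1 x
  ⨯-·-self : ∀ x z → (x ⨯ (z · x)) ≈ᴹ ((⟪ 1A , z ⟫ *ₗ (x #)) ∸ᴹ ((x #) · z))
  ⨯-·-self x z = begin
    x ⨯ (z · x)                         ≈⟨ ⨯-cong (≈ᴹ-sym (·-identityˡ x)) ≈ᴹ-refl ⟩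
    (1A · x) ⨯ (z · x)                  ≈⟨ ⨯-·ʳ 1A z x ⟩
    (x #) · (1A ⨯ z)                    ≈⟨ ·-cong ≈ᴹ-refl (1-⨯ z) ⟩
    (x #) · ((⟪ 1A , z ⟫ *ₗ 1A) ∸ᴹ z)   ≈⟨ ·-∸ʳ _ _ _ ⟩
    ((x #) · (⟪ 1A , z ⟫ *ₗ 1A)) ∸ᴹ ((x #) · z)
      ≈⟨ ∸ᴹ-cong (≈ᴹ-trans (·-*ₗ-assocʳ _ _ _) (*ₗ-congˡ (·-identityʳ _))) ≈ᴹ-refl ⟩
    (⟪ 1A , z ⟫ *ₗ (x #)) ∸ᴹ ((x #) · z) ∎
    where open SetoidReasoning ≈ᴹ-setoid

  ·-⨯-+ : ∀ x y → ((x · (x ⨯ y)) +ᴹ (y · (x #))) ≈ᴹ (⟪ x # , y ⟫ *ₗ 1A)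
  ·-⨯-+ x y = ≈ᴹ-by-pairing _ _ λ z → begin
    ⟪ (x · (x ⨯ y)) +ᴹ (y · (x #)) , z ⟫      ≈⟨ ⟪⟫-+ˡ _ _ z ⟩
    ⟪ x · (x ⨯ y) , z ⟫ + ⟪ y · (x #) , z ⟫   ≈⟨ +-cong (first z) (trans (⟪⟫-assoc y (x #) z) (⟪⟫-sym _ _)) ⟩
    (⟪ 1A , z ⟫ * ⟪ x # , y ⟫ + - ⟪ (x #) · z , y ⟫) + ⟪ (x #) · z , y ⟫
      ≈⟨ +F.//-rightDividesˡ _ _ ⟩
    ⟪ 1A , z ⟫ * ⟪ x # , y ⟫                  ≈⟨ *-comm _ _ ⟩
    ⟪ x # , y ⟫ * ⟪ 1A , z ⟫                  ≈⟨ ⟪⟫-*ₗˡ _ _ _ ⟨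
    ⟪ ⟪ x # , y ⟫ *ₗ 1A , z ⟫                 ∎
    where
    open SetoidReasoning setoid
    first : ∀ z → ⟪ x · (x ⨯ y) , z ⟫ ≈ ⟪ 1A , z ⟫ * ⟪ x # , y ⟫ + - ⟪ (x #) · z , y ⟫
    first z = begin
      ⟪ x · (x ⨯ y) , z ⟫   ≈⟨ ⟪⟫-sym _ _ ⟩
      ⟪ z , x · (x ⨯ y) ⟫   ≈⟨ ⟪⟫-assoc z x _ ⟨
      ⟪ z · x , x ⨯ y ⟫     ≈⟨ ⟪⟫-sym _ _ ⟩
      ⟪ x ⨯ y , z · x ⟫     ≈⟨ ⟪⨯⟫-swap x y (z · x) ⟩
      ⟪ x ⨯ (z · x) , y ⟫   ≈⟨ ⟪⟫-cong (⨯-·-self x z) ≈ᴹ-refl ⟩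
      ⟪ (⟪ 1A , z ⟫ *ₗ (x #)) ∸ᴹ ((x #) · z) , y ⟫       ≈⟨ ⟪⟫-∸ˡ _ _ _ ⟩
      ⟪ ⟪ 1A , z ⟫ *ₗ (x #) , y ⟫ + - ⟪ (x #) · z , y ⟫  ≈⟨ +-congʳ (⟪⟫-*ₗˡ _ _ _) ⟩
      ⟪ 1A , z ⟫ * ⟪ x # , y ⟫ + - ⟪ (x #) · z , y ⟫    ∎

  -- x (x × y) x = ⟪x# , y⟫ x - n(x) y: multiply ·-⨯-+ by x on the right
  sandwich : ∀ x y → ((x · (x ⨯ y)) · x) ≈ᴹ ((⟪ x # , y ⟫ *ₗ x) ∸ᴹ (n x *ₗ y))
  sandwich x y = begin
    (x · (x ⨯ y)) · x                                        ≈⟨ +ᴹ.//-rightDividesʳ ((y · (x #)) · x) _ ⟨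
    (((x · (x ⨯ y)) · x) +ᴹ ((y · (x #)) · x)) ∸ᴹ ((y · (x #)) · x)
      ≈⟨ ∸ᴹ-cong (≈ᴹ-sym (·-distribʳ x _ _)) y-term ⟩
    (((x · (x ⨯ y)) +ᴹ (y · (x #))) · x) ∸ᴹ (n x *ₗ y)
      ≈⟨ ∸ᴹ-cong (·-cong (·-⨯-+ x y) ≈ᴹ-refl) ≈ᴹ-refl ⟩
    ((⟪ x # , y ⟫ *ₗ 1A) · x) ∸ᴹ (n x *ₗ y)
      ≈⟨ ∸ᴹ-cong (≈ᴹ-trans (·-*ₗ-assocˡ _ 1A x) (*ₗ-congˡ (·-identityˡ x))) ≈ᴹ-refl ⟩
    (⟪ x # , y ⟫ *ₗ x) ∸ᴹ (n x *ₗ y)                         ∎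
    where
    open SetoidReasoning ≈ᴹ-setoid
    y-term : ((y · (x #)) · x) ≈ᴹ (n x *ₗ y)
    y-term = ≈ᴹ-trans (·-assoc y (x #) x)
      (≈ᴹ-trans (·-cong ≈ᴹ-refl (·-#ˡ x))
        (≈ᴹ-trans (·-*ₗ-assocʳ _ y 1A) (*ₗ-congˡ (·-identityʳ y))))

  #-⨯ : ∀ x w → ((x #) ⨯ w) ≈ᴹ ((⟪ x , w ⟫ *ₗ x) ∸ᴹ ((x · w) · x))
  #-⨯ x w = ≈ᴹ-by-pairing _ _ λ z → begin
    ⟪ (x #) ⨯ w , z ⟫                 ≈⟨ ⟪⨯⟫-assoc _ _ _ ⟩
    ⟪ x # , w ⨯ z ⟫                   ≈⟨ ⟪⟫-sym _ _ ⟩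
    ⟪ w ⨯ z , x # ⟫                   ≈⟨ ⟪⟫-trace _ _ ⟩
    ⟪ 1A , (w ⨯ z) · (x #) ⟫          ≈⟨ ⟪⟫-cong ≈ᴹ-refl (≈ᴹ-sym (⨯-·ˡ w z x)) ⟩
    ⟪ 1A , (x · w) ⨯ (x · z) ⟫        ≈⟨ ⟪⨯⟫-assoc _ _ _ ⟨
    ⟪ 1A ⨯ (x · w) , x · z ⟫          ≈⟨ ⟪⟫-cong (1-⨯ _) ≈ᴹ-refl ⟩
    ⟪ (⟪ 1A , x · w ⟫ *ₗ 1A) ∸ᴹ (x · w) , x · z ⟫            ≈⟨ ⟪⟫-∸ˡ _ _ _ ⟩
    ⟪ ⟪ 1A , x · w ⟫ *ₗ 1A , x · z ⟫ + - ⟪ x · w , x · z ⟫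
      ≈⟨ +-congʳ (trans (⟪⟫-*ₗˡ _ _ _) (*-cong (sym (⟪⟫-trace x w)) (sym (⟪⟫-trace x z)))) ⟩
    ⟪ x , w ⟫ * ⟪ x , z ⟫ + - ⟪ x · w , x · z ⟫
      ≈⟨ +-cong (⟪⟫-*ₗˡ _ _ _) (-‿cong (⟪⟫-assoc _ _ _)) ⟨
    ⟪ ⟪ x , w ⟫ *ₗ x , z ⟫ + - ⟪ (x · w) · x , z ⟫           ≈⟨ ⟪⟫-∸ˡ _ _ _ ⟨
    ⟪ (⟪ x , w ⟫ *ₗ x) ∸ᴹ ((x · w) · x) , z ⟫                ∎
    where open SetoidReasoning setoid

  -- the adjoint identity: take w = x × y in #-⨯ and use ⟪x , x × y⟫ = 2 ⟪x# , y⟫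
  adjoint-identity : ∀ x y → ((x #) ⨯ (x ⨯ y)) ≈ᴹ ((n x *ₗ y) +ᴹ (⟪ x # , y ⟫ *ₗ x))
  adjoint-identity x y = begin
    (x #) ⨯ (x ⨯ y)                                 ≈⟨ #-⨯ x (x ⨯ y) ⟩
    (⟪ x , x ⨯ y ⟫ *ₗ x) ∸ᴹ ((x · (x ⨯ y)) · x)
      ≈⟨ ∸ᴹ-cong (≈ᴹ-trans (*ₗ-congʳ (⟪⟫-⨯-self x y)) (*ₗ-distribʳ x _ _)) (sandwich x y) ⟩
    (a +ᴹ a) ∸ᴹ (a ∸ᴹ b)                            ≈⟨ +ᴹ-congˡ (+ᴹ.⁻¹-anti-homo-// a b) ⟩
    (a +ᴹ a) +ᴹ (b ∸ᴹ a)                            ≈⟨ +ᴹ-congˡ (+ᴹ-comm b (-ᴹ a)) ⟩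
    (a +ᴹ a) +ᴹ ((-ᴹ a) +ᴹ b)                       ≈⟨ +ᴹ-assoc (a +ᴹ a) (-ᴹ a) b ⟨
    ((a +ᴹ a) ∸ᴹ a) +ᴹ b                            ≈⟨ +ᴹ-congʳ (+ᴹ.//-rightDividesʳ a a) ⟩
    a +ᴹ b                                          ≈⟨ +ᴹ-comm a b ⟩
    b +ᴹ a                                          ∎
    where
    open SetoidReasoning ≈ᴹ-setoid
    a = ⟪ x # , y ⟫ *ₗ x
    b = n x *ₗ y

  #·-⨯ : ∀ s t y → (((s #) · t) ⨯ y) ≈ᴹ ((t ⨯ (s · y)) · s)
  #·-⨯ s t y = ≈ᴹ-by-pairing _ _ λ z → begin
    ⟪ ((s #) · t) ⨯ y , z ⟫          ≈⟨ ⟪⨯⟫-assoc _ _ _ ⟩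
    ⟪ (s #) · t , y ⨯ z ⟫            ≈⟨ ⟪⟫-sym _ _ ⟩
    ⟪ y ⨯ z , (s #) · t ⟫            ≈⟨ ⟪⟫-assoc _ _ _ ⟨
    ⟪ (y ⨯ z) · (s #) , t ⟫          ≈⟨ ⟪⟫-cong (≈ᴹ-sym (⨯-·ˡ y z s)) ≈ᴹ-refl ⟩
    ⟪ (s · y) ⨯ (s · z) , t ⟫        ≈⟨ ⟪⟫-sym _ _ ⟩
    ⟪ t , (s · y) ⨯ (s · z) ⟫        ≈⟨ ⟪⨯⟫-assoc _ _ _ ⟨
    ⟪ t ⨯ (s · y) , s · z ⟫          ≈⟨ ⟪⟫-assoc _ _ _ ⟨
    ⟪ (t ⨯ (s · y)) · s , z ⟫        ∎
    where open SetoidReasoning setoid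

module ShriekVectors {c ℓ m ℓm : Level} {F : Field c ℓ}
                     (AS : AssocCubicNormStructure F m ℓm) where
  open Field F
  open AssocCubicNormStructure AS
  open FreudenthalSpace AS
  open Identities AS
  open AdjointIdentity AS

  #-of-#· : ∀ s t → (((s #) · t) #) ≈ᴹ (n s *ₗ ((t #) · s))
  #-of-#· s t = ≈ᴹ-trans (#-antimult (s #) t)
    (≈ᴹ-trans (·-cong ≈ᴹ-refl (## s)) (·-*ₗ-assocʳ (n s) (t #) s))

  ⨯-⨯-of-#· : ∀ s t y → (((t #) · s) ⨯ (((s #) · t) ⨯ y)) ≈ᴹ
                        (((n s * n t) *ₗ y) +ᴹ (⟪ (t #) · s , y ⟫ *ₗ ((s #) · t)))
  ⨯-⨯-of-#· s t y = begin
    ((t #) · s) ⨯ (((s #) · t) ⨯ y)        ≈⟨ ⨯-cong ≈ᴹ-refl (#·-⨯ s t y) ⟩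
    ((t #) · s) ⨯ ((t ⨯ (s · y)) · s)      ≈⟨ ⨯-·ʳ (t #) (t ⨯ (s · y)) s ⟩
    (s #) · ((t #) ⨯ (t ⨯ (s · y)))        ≈⟨ ·-cong ≈ᴹ-refl (adjoint-identity t (s · y)) ⟩
    (s #) · ((n t *ₗ (s · y)) +ᴹ (⟪ t # , s · y ⟫ *ₗ t))              ≈⟨ ·-distribˡ _ _ _ ⟩
    ((s #) · (n t *ₗ (s · y))) +ᴹ ((s #) · (⟪ t # , s · y ⟫ *ₗ t))
      ≈⟨ +ᴹ-cong (·-*ₗ-assocʳ _ _ _) (·-*ₗ-assocʳ _ _ _) ⟩
    (n t *ₗ ((s #) · (s · y))) +ᴹ (⟪ t # , s · y ⟫ *ₗ ((s #) · t))
      ≈⟨ +ᴹ-cong (*ₗ-congˡ s#sy) (*ₗ-congʳ (sym (⟪⟫-assoc (t #) s y))) ⟩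
    (n t *ₗ (n s *ₗ y)) +ᴹ (⟪ (t #) · s , y ⟫ *ₗ ((s #) · t))
      ≈⟨ +ᴹ-congʳ (≈ᴹ-trans (≈ᴹ-sym (*ₗ-assoc (n t) (n s) y)) (*ₗ-congʳ (*-comm (n t) (n s)))) ⟩
    ((n s * n t) *ₗ y) +ᴹ (⟪ (t #) · s , y ⟫ *ₗ ((s #) · t)) ∎
    where
    open SetoidReasoning ≈ᴹ-setoid
    s#sy : ((s #) · (s · y)) ≈ᴹ (n s *ₗ y)
    s#sy = ≈ᴹ-trans (≈ᴹ-sym (·-assoc (s #) s y))
      (≈ᴹ-trans (·-cong (·-#ˡ s) ≈ᴹ-refl)
        (≈ᴹ-trans (·-*ₗ-assocˡ _ 1A y) (*ₗ-congˡ (·-identityˡ y))))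

  row-rank-one : ∀ ℓv → RankAtMostOne (ℓv !ʳ)
  row-rank-one (row s t) = #-of-#· s t , #-of-#· t s , ⨯-⨯-of-#· s t ,
    λ y → ≈ᴹ-trans (⨯-⨯-of-#· t s y) (+ᴹ-congʳ (*ₗ-congʳ (*-comm (n t) (n s))))

  pairing : ∀ ℓv η → ⟨ ℓv !ʳ , η !ᶜ ⟩W ≈ n ((ℓv ·J) ⊙ η)
  pairing (row s t) (col u v) = sym (begin
    n ((-ᴹ t) · u +ᴹ s · v)          ≈⟨ n-cong (+ᴹ-congʳ (·-negˡ t u)) ⟩
    n (-ᴹ (t · u) +ᴹ s · v)          ≈⟨ n-+ _ _ ⟩
    n (-ᴹ (t · u)) + ⟪ (-ᴹ (t · u)) # , s · v ⟫ + ⟪ -ᴹ (t · u) , (s · v) # ⟫ + n (s · v)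
      ≈⟨ +-congʳ (+-cong (+-cong (n-negate _) (⟪⟫-cong (#-negate _) ≈ᴹ-refl)) (⟪⟫-negˡ _ _)) ⟩
    - n (t · u) + ⟪ (t · u) # , s · v ⟫ + - ⟪ t · u , (s · v) # ⟫ + n (s · v)
      ≈⟨ +-cong (+-cong (+-cong (-‿cong (n-mult t u)) (⟪#,⟫-rotate t u s v))
                        (-‿cong (trans (⟪⟫-sym _ _) (⟪#,⟫-rotate s v t u))))
                (n-mult s v) ⟩
    - (n t * n u) + Q + - P + n s * n v
      ≈⟨ +-Solver.solve 4 (λ a b c d → ((a ⊕ b) ⊕ c) ⊕ d ⊜ ((d ⊕ c) ⊕ b) ⊕ a)
           refl (- (n t * n u)) Q (- P) (n s * n v) ⟩
    n s * n v + - P + Q + - (n t * n u) ∎)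
    where
    open SetoidReasoning setoid
    open +-Solver using (_⊕_; _⊜_)
    P = ⟪ (s #) · t , u · (v #) ⟫
    Q = ⟪ (t #) · s , v · (u #) ⟫

lemma4p20 : ∀ {c ℓ m ℓm : Level} (F : Field c ℓ) → CharacteristicZero F →
    (AS : AssocCubicNormStructure F m ℓm) →
    let open Field F
        open AssocCubicNormStructure AS
        open FreudenthalSpace AS
    in (ℓv : Row) (η : Col) →
       RankAtMostOne (ℓv !ʳ) × RankAtMostOne (η !ᶜ) ×
       (⟨ ℓv !ʳ , η !ᶜ ⟩W ≈ n ((ℓv ·J) ⊙ η))
lemma4p20 F _ AS ℓv (FreudenthalSpace.col u v) =
  ShriekVectors.row-rank-one AS ℓv ,
  -- the column (u , v)ᵗ of A is the row (u , v) of the opposite algebra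
  ShriekVectors.row-rank-one (opposite AS) (FreudenthalSpace.row u v) ,
  ShriekVectors.pairing AS ℓv (FreudenthalSpace.col u v)
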